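{- Let $K_n$ denote the complete graph on $n$ vertices. For every $n\geq 3$ with $n\neq 4$, $\overline{\chi^e_{\Sigma}}(K_n)=3$, while $\overline{\chi^e_{\Sigma}}(K_4)=4$.
   Context: All graphs are finite, simple and undirected. An edge $k$-colouring of a graph $G$ is any (not necessarily proper) map $\gamma:E(G)\to\{1,\dots,k\}$; it induces the vertex colouring $\sigma_\gamma(v)=\sum_{e\ni v}\gamma(e)$. It is neighbour-sum-distinguishing if $\sigma_\gamma(u)\neq\sigma_\gamma(v)$ for every edge $uv\in E(G)$. A colouring with colours from $\{1,\dots,k\}$ is equitable if for any two colours $i,j\in\{1,\dots,k\}$ the numbers of coloured elements receiving colour $i$ and colour $j$ differ by at most one. For a graph $G$ with no isolated edge (no connected component isomorphic to $K_2$), $\overline{\chi^e_{\Sigma}}(G)$ is the smallest $k$ such that $G$ admits an equitable neighbour-sum-distinguishing edge $k$-colouring. -}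

module Defs where

open import Data.Nat using (ℕ; suc; _≤_; _<?_)
open import Data.Fin using (Fin; toℕ)
open import Data.Fin.Properties using () renaming (_≟_ to _≟ᶠ_)
open import Data.Nat.ListAction using (sum)
open import Data.List using (List; map; length; filter; cartesianProduct; allFin)
open import Data.Product using (_×_; _,_; Σ; proj₁)
open import Relation.Nullary using (yes; no)
open import Relation.Binary.PropositionalEquality using (_≡_; _≢_)

-- The complete graph K_n has vertex set Fin n and an edge {i,j} for every i ≢ j.
-- An edge k-colouring of K_n: a symmetric map assigning to each pair of vertices
-- a colour in Fin k; colour c ∈ Fin k stands for the integer (toℕ c + 1) ∈ {1,…,k}.
-- (Diagonal values are never used.)
record EdgeColouring (n k : ℕ) : Set where
  field
    col : Fin n → Fin n → Fin k
    sym : ∀ i j → col i j ≡ col j i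
open EdgeColouring public

val : ∀ {n k} → EdgeColouring n k → Fin n → Fin n → ℕ
val γ u v = suc (toℕ (col γ u v))

σ : ∀ {n k} → EdgeColouring n k → Fin n → ℕ
σ γ v = sum (map (λ u → term u) (allFin _))
  where
  term : Fin _ → ℕ
  term u with u ≟ᶠ v
  ... | yes _ = 0
  ... | no _  = val γ u v

-- neighbour-sum-distinguishing in K_n: every two distinct vertices are adjacent
NSD : ∀ {n k} → EdgeColouring n k → Set
NSD {n} γ = ∀ (u v : Fin n) → u ≢ v → σ γ u ≢ σ γ v

edges : (n : ℕ) → List (Fin n × Fin n)
edges n = filter (λ p → toℕ (Data.Product.proj₁ p) <? toℕ (Data.Product.proj₂ p))
                 (cartesianProduct (allFin n) (allFin n))

count : ∀ {n k} → EdgeColouring n k → Fin k → ℕ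
count {n} γ a = length (filter (λ p → col γ (Data.Product.proj₁ p) (Data.Product.proj₂ p) ≟ᶠ a) (edges n))

Equitable : ∀ {n k} → EdgeColouring n k → Set
Equitable {k = k} γ = ∀ (a b : Fin k) → count γ a ≤ suc (count γ b)

HasEqNSD : ℕ → ℕ → Set
HasEqNSD n k = Σ (EdgeColouring n k) (λ γ → NSD γ × Equitable γ)

EqNSDIndex≡ : ℕ → ℕ → Set
EqNSDIndex≡ n k = HasEqNSD n k × (∀ m → HasEqNSD n m → k ≤ m)

module Submission where

-- With one colour all vertex sums of K_n (n ≥ 2) coincide; with two,
-- the n distinct sums fill the n-element range [n-1, 2(n-1)], so one vertex sees only
-- colour 1 and another only colour 2, absurd on their common edge.  For K_4 three
-- colours fail as well, by exhaustive search over the 3^6 edge colourings.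
--
-- K_4 gets an explicit 4-colouring.  Otherwise an invariant (counts
-- a, a+e, a; all sums within M of 2n-2; M small) is carried from K_n to K_{n+2} by
-- adding vertices ℓ, h: x old vertices are joined to them by colours 1 and 3, the
-- rest by 2 and 2.  Old sums grow by 4 and stay strictly inside the new window of
-- radius x whose ends are σ(ℓ) and σ(h).  Base cases K_3 and K_6 are explicit.

open import Defs hiding (sym)
open EdgeColouring using () renaming (sym to col-sym)

open import Data.Bool using (true; false; T; if_then_else_)
open import Data.Empty using (⊥; ⊥-elim)
open import Data.Fin using (Fin; zero; suc; toℕ; fromℕ<)
open import Data.Fin.Properties using (all?; any?; pigeonhole; toℕ-injective; toℕ-fromℕ<)
  renaming (_≟_ to _≟ᶠ_; <⇒≢ to <⇒≢ᶠ)
open import Data.List using (List; []; _∷_; map; allFin; filter; length; cartesianProduct)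
open import Data.List.Properties using (map-tabulate; map-cong; map-++; map-∘; filter-≐)
open import Data.Nat using (ℕ; zero; suc; pred; NonZero; ≢-nonZero; _+_; _*_; _∸_; _≤_; _<_; z≤n; s≤s; _≤ᵇ_; _<ᵇ_; _≤?_)
  renaming (_≟_ to _≟ℕ_)
open import Data.Nat.ListAction using (sum)
open import Data.Nat.ListAction.Properties using (sum-++)
open import Data.Nat.Properties
open import Data.Nat.Tactic.RingSolver using (solve-∀)
open import Data.Product using (Σ; ∃; _×_; _,_; proj₁; proj₂)
open import Data.Sum using (inj₁; inj₂)
open import Data.Unit using (tt)
open import Data.Vec using (Vec; []; _∷_; lookup)
open import Function using (_∘_; id)
open import Relation.Nullary using (Dec; yes; no; does; ¬_; ¬?)
open import Relation.Nullary.Decidable using (_→-dec_; _×-dec_; from-yes; toWitness)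
open import Relation.Unary using (Decidable)
open import Relation.Binary.PropositionalEquality

∑ : (n : ℕ) → (Fin n → ℕ) → ℕ
∑ n f = sum (map f (allFin n))

∑-suc : ∀ n (f : Fin (suc n) → ℕ) → ∑ (suc n) f ≡ f zero + ∑ n (f ∘ suc)
∑-suc n f = cong (λ l → f zero + sum l)
  (trans (map-tabulate suc f) (sym (map-tabulate id (f ∘ suc))))

∑-cong : ∀ n {f g : Fin n → ℕ} → (∀ u → f u ≡ g u) → ∑ n f ≡ ∑ n g
∑-cong n f≗g = cong sum (map-cong f≗g (allFin n))

∑-const : ∀ n c → ∑ n (λ _ → c) ≡ n * c
∑-const zero    c = refl
∑-const (suc n) c = trans (∑-suc n (λ _ → c)) (cong (c +_) (∑-const n c))

∑-mono : ∀ n {f g : Fin n → ℕ} → (∀ u → f u ≤ g u) → ∑ n f ≤ ∑ n g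
∑-mono zero    f≤g = z≤n
∑-mono (suc n) {f} {g} f≤g = begin
  ∑ (suc n) f            ≡⟨ ∑-suc n f ⟩
  f zero + ∑ n (f ∘ suc)  ≤⟨ +-mono-≤ (f≤g zero) (∑-mono n (f≤g ∘ suc)) ⟩
  g zero + ∑ n (g ∘ suc)  ≡⟨ ∑-suc n g ⟨
  ∑ (suc n) g            ∎
  where open ≤-Reasoning

+-tight : ∀ {a b c d} → a ≤ b → c ≤ d → a + c ≡ b + d → a ≡ b × c ≡ d
+-tight {a} {b} {c} {d} a≤b c≤d eq = a≡b , +-cancelˡ-≡ a c d (trans eq (cong (_+ d) (sym a≡b)))
  where
  a≡b : a ≡ b
  a≡b = ≤-antisym a≤b (+-cancelʳ-≤ c b a (≤-trans (+-monoʳ-≤ b c≤d) (≤-reflexive (sym eq))))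

∑-tight : ∀ n {f g : Fin n → ℕ} → (∀ u → f u ≤ g u) → ∑ n f ≡ ∑ n g → ∀ u → f u ≡ g u
∑-tight (suc n) {f} {g} f≤g eq u with +-tight (f≤g zero) (∑-mono n (f≤g ∘ suc))
                                          (trans (sym (∑-suc n f)) (trans eq (∑-suc n g)))
∑-tight (suc n) f≤g eq zero    | f0≡g0 , _      = f0≡g0
∑-tight (suc n) f≤g eq (suc u) | _     , rest≡ = ∑-tight n (f≤g ∘ suc) rest≡ u

omit : ∀ {n} → Fin n → (Fin n → ℕ) → Fin n → ℕ
omit v f u = if does (u ≟ᶠ v) then 0 else f u

omit-≢ : ∀ {n} {u v : Fin n} (f : Fin n → ℕ) → u ≢ v → omit v f u ≡ f u
omit-≢ {u = u} {v} f u≢v with u ≟ᶠ v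
... | yes u≡v = ⊥-elim (u≢v u≡v)
... | no _    = refl

omit-mono : ∀ {n} (v : Fin n) {f g : Fin n → ℕ} → (∀ u → f u ≤ g u) → ∀ u → omit v f u ≤ omit v g u
omit-mono v f≤g u with does (u ≟ᶠ v)
... | true  = z≤n
... | false = f≤g u

omit-cong : ∀ {n} (v : Fin n) {f g : Fin n → ℕ} → (∀ u → f u ≡ g u) → ∀ u → omit v f u ≡ omit v g u
omit-cong v f≗g u = cong (λ z → if does (u ≟ᶠ v) then 0 else z) (f≗g u)

∑-omit : ∀ n (f : Fin n → ℕ) v → ∑ n f ≡ f v + ∑ n (omit v f)
∑-omit (suc n) f zero = trans (∑-suc n f)
  (cong (f zero +_) (sym (∑-suc n (omit zero f))))
∑-omit (suc n) f (suc v) = begin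
  ∑ (suc n) f                                      ≡⟨ ∑-suc n f ⟩
  f zero + ∑ n (f ∘ suc)                           ≡⟨ cong (f zero +_) (∑-omit n (f ∘ suc) v) ⟩
  f zero + (f (suc v) + ∑ n (omit v (f ∘ suc)))    ≡⟨ swap-front (f zero) (f (suc v)) _ ⟩
  f (suc v) + (f zero + ∑ n (omit v (f ∘ suc)))    ≡⟨ cong (f (suc v) +_) (∑-suc n (omit (suc v) f)) ⟨
  f (suc v) + ∑ (suc n) (omit (suc v) f)           ∎
  where
  open ≡-Reasoning
  swap-front : ∀ a b c → a + (b + c) ≡ b + (a + c)
  swap-front = solve-∀

∑-omit-const : ∀ m c (v : Fin (suc m)) → ∑ (suc m) (omit v (λ _ → c)) ≡ m * c
∑-omit-const m c v = +-cancelˡ-≡ c _ _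
  (trans (sym (∑-omit (suc m) (λ _ → c) v)) (∑-const (suc m) c))

threshold : {A : Set} → ℕ → A → A → ℕ → A
threshold x p q i = if i <ᵇ x then p else q

threshold-map : {A B : Set} (f : A → B) (x : ℕ) (p q : A) (i : ℕ) →
                f (threshold x p q i) ≡ threshold x (f p) (f q) i
threshold-map f x p q i with i <ᵇ x
... | true  = refl
... | false = refl

∑-threshold : ∀ x r p q → ∑ (x + r) (λ u → threshold x p q (toℕ u)) ≡ x * p + r * q
∑-threshold zero    r p q = ∑-const r q
∑-threshold (suc x) r p q = trans (∑-suc (x + r) _)
  (trans (cong (p +_) (∑-threshold x r p q)) (sym (+-assoc p (x * p) (r * q))))

σ-as-∑ : ∀ {n k} (γ : EdgeColouring n k) v → σ γ v ≡ ∑ n (omit v (λ u → val γ u v))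
σ-as-∑ {n} γ v = trans (proj₂ summand) (∑-cong n pointwise)
  where
  -- the summand used in Defs is local to σ; this names it
  summand : Σ (Fin n → ℕ) λ f → σ γ v ≡ ∑ n f
  summand = _ , refl
  pointwise : ∀ u → proj₁ summand u ≡ omit v (λ u → val γ u v) u
  pointwise u with u ≟ᶠ v
  ... | yes _ = refl
  ... | no _  = refl

σ-cong : ∀ {n k} (γ δ : EdgeColouring n k) → (∀ u v → col γ u v ≡ col δ u v) → ∀ v → σ γ v ≡ σ δ v
σ-cong {n} γ δ γ≗δ v = begin
  σ γ v                                    ≡⟨ σ-as-∑ γ v ⟩
  ∑ n (omit v (λ u → val γ u v))           ≡⟨ ∑-cong n (omit-cong v (λ u → cong (suc ∘ toℕ) (γ≗δ u v))) ⟩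
  ∑ n (omit v (λ u → val δ u v))           ≡⟨ σ-as-∑ δ v ⟨
  σ δ v                                    ∎
  where open ≡-Reasoning

count-cong : ∀ {n k} (γ δ : EdgeColouring n k) → (∀ u v → col γ u v ≡ col δ u v) → ∀ a → count γ a ≡ count δ a
count-cong {n} γ δ γ≗δ a = cong length (filter-≐ _ _ ((λ e → trans (sym (γ≗δ _ _)) e) , (λ e → trans (γ≗δ _ _) e)) (edges n))

transfer : ∀ {n k} (γ δ : EdgeColouring n k) → (∀ u v → col γ u v ≡ col δ u v) →
           NSD γ × Equitable γ → NSD δ × Equitable δ
transfer γ δ γ≗δ (nsd , eq) =
  (λ u v u≢v σδ≡ → nsd u v u≢v (trans (σ-cong γ δ γ≗δ u) (trans σδ≡ (sym (σ-cong γ δ γ≗δ v))))) ,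
  (λ a b → subst₂ (λ p q → p ≤ suc q) (count-cong γ δ γ≗δ a) (count-cong γ δ γ≗δ b) (eq a b))

indicator : ∀ {k} → Fin k → Fin k → ℕ
indicator c a = if does (c ≟ᶠ a) then 1 else 0

edge-indicator : ∀ {n k} → EdgeColouring n k → Fin k → Fin n → Fin n → ℕ
edge-indicator γ a i j = if toℕ i <ᵇ toℕ j then indicator (col γ i j) a else 0

length-filter-filter : {A : Set} {P Q : A → Set} (P? : Decidable P) (Q? : Decidable Q) (xs : List A) →
  length (filter P? (filter Q? xs)) ≡ sum (map (λ x → if does (Q? x) then (if does (P? x) then 1 else 0) else 0) xs)
length-filter-filter P? Q? [] = refl
length-filter-filter P? Q? (x ∷ xs) with does (Q? x)
... | false = length-filter-filter P? Q? xs
... | true with does (P? x)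
...   | false = length-filter-filter P? Q? xs
...   | true  = cong suc (length-filter-filter P? Q? xs)

sum-cartesianProduct : {A B : Set} (h : A × B → ℕ) (xs : List A) (ys : List B) →
  sum (map h (cartesianProduct xs ys)) ≡ sum (map (λ x → sum (map (λ y → h (x , y)) ys)) xs)
sum-cartesianProduct h [] ys = refl
sum-cartesianProduct h (x ∷ xs) ys = trans (cong sum (map-++ h (map (x ,_) ys) _))
  (trans (sum-++ (map h (map (x ,_) ys)) _)
   (cong₂ _+_ (cong sum (sym (map-∘ {g = h} {f = (x ,_)} ys))) (sum-cartesianProduct h xs ys)))

count-as-∑ : ∀ {n k} (γ : EdgeColouring n k) a → count γ a ≡ ∑ n (λ i → ∑ n (edge-indicator γ a i))
count-as-∑ {n} γ a = trans (length-filter-filter _ _ (cartesianProduct (allFin n) (allFin n)))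
  (sum-cartesianProduct _ (allFin n) (allFin n))

fromUpper : ∀ {n k} → (Fin n → Fin n → Fin k) → EdgeColouring n k
fromUpper {n} {k} t = record { col = c ; sym = c-sym }
  where
  c : Fin n → Fin n → Fin k
  c i j = if toℕ i ≤ᵇ toℕ j then t i j else t j i
  c-sym : ∀ i j → c i j ≡ c j i
  c-sym i j with toℕ i ≤ᵇ toℕ j in i≤ᵇj | toℕ j ≤ᵇ toℕ i in j≤ᵇi
  ... | true  | true  = cong₂ t i≡j (sym i≡j)
    where
    i≡j : i ≡ j
    i≡j = toℕ-injective (≤-antisym (≤ᵇ⇒≤ _ _ (subst T (sym i≤ᵇj) tt)) (≤ᵇ⇒≤ _ _ (subst T (sym j≤ᵇi) tt)))
  ... | true  | false = refl
  ... | false | true  = refl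
  ... | false | false with ≤-total (toℕ i) (toℕ j)
  ...   | inj₁ i≤j = ⊥-elim (subst T i≤ᵇj (≤⇒≤ᵇ i≤j))
  ...   | inj₂ j≤i = ⊥-elim (subst T j≤ᵇi (≤⇒≤ᵇ j≤i))

fromUpper-agrees : ∀ {n k} (γ : EdgeColouring n k) (t : Fin n → Fin n → Fin k) →
                   (∀ i j → t i j ≡ col γ i j) → ∀ i j → col (fromUpper t) i j ≡ col γ i j
fromUpper-agrees γ t t≗γ i j with toℕ i ≤ᵇ toℕ j
... | true  = t≗γ i j
... | false = trans (t≗γ j i) (col-sym γ j i)

fromMatrix : ∀ {n k} → Vec (Vec (Fin k) n) n → EdgeColouring n k
fromMatrix M = fromUpper (λ i j → lookup (lookup M i) j)

-- Decision procedures; on concrete colourings they settle the properties by evaluation.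
NSD? : ∀ {n k} (γ : EdgeColouring n k) → Dec (NSD γ)
NSD? γ = all? λ u → all? λ v → ¬? (u ≟ᶠ v) →-dec ¬? (σ γ u ≟ℕ σ γ v)

Equitable? : ∀ {n k} (γ : EdgeColouring n k) → Dec (Equitable γ)
Equitable? γ = all? λ a → all? λ b → count γ a ≤? suc (count γ b)

EqNSD? : ∀ {n k} (γ : EdgeColouring n k) → Dec (NSD γ × Equitable γ)
EqNSD? γ = NSD? γ ×-dec Equitable? γ

pred-< : ∀ {a m} → a ≢ 0 → a ≤ m → pred a < m
pred-< {zero}  a≢0 _   = ⊥-elim (a≢0 refl)
pred-< {suc a} _   a≤m = a≤m

-- A map from m+1 points to {0,…,m} without collisions takes the value 0: otherwise
-- pred ∘ f would squeeze m+1 points into Fin m (pigeonhole).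
hits-zero : ∀ m (f : Fin (suc m) → ℕ) → (∀ i j → i ≢ j → f i ≢ f j) → (∀ i → f i ≤ m) →
            ∃ λ i → f i ≡ 0
hits-zero m f distinct f≤m with any? (λ i → f i ≟ℕ 0)
... | yes found = found
... | no none with pigeonhole (n<1+n m) (λ i → fromℕ< (pred-< (λ fi≡0 → none (i , fi≡0)) (f≤m i)))
...   | i , j , i<j , squeezed≡ = ⊥-elim (distinct i j (<⇒≢ᶠ i<j) (pred-injective {{nonzero i}} {{nonzero j}} pred≡))
  where
  nonzero : ∀ i → NonZero (f i)
  nonzero i = ≢-nonZero (λ fi≡0 → none (i , fi≡0))
  pred≡ : pred (f i) ≡ pred (f j)
  pred≡ = trans (sym (toℕ-fromℕ< _)) (trans (cong toℕ squeezed≡) (toℕ-fromℕ< _))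

module VertexSumBounds {m k : ℕ} (γ : EdgeColouring (suc m) k) (c : ℕ) where

  σ-≥ : (∀ u v → c ≤ val γ u v) → ∀ v → m * c ≤ σ γ v
  σ-≥ c≤ v = begin
    m * c                               ≡⟨ ∑-omit-const m c v ⟨
    ∑ (suc m) (omit v (λ _ → c))         ≤⟨ ∑-mono (suc m) (omit-mono v (λ u → c≤ u v)) ⟩
    ∑ (suc m) (omit v (λ u → val γ u v)) ≡⟨ σ-as-∑ γ v ⟨
    σ γ v                               ∎
    where open ≤-Reasoning

  σ-≤ : (∀ u v → val γ u v ≤ c) → ∀ v → σ γ v ≤ m * c
  σ-≤ ≤c v = begin
    σ γ v                               ≡⟨ σ-as-∑ γ v ⟩
    ∑ (suc m) (omit v (λ u → val γ u v)) ≤⟨ ∑-mono (suc m) (omit-mono v (λ u → ≤c u v)) ⟩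
    ∑ (suc m) (omit v (λ _ → c))         ≡⟨ ∑-omit-const m c v ⟩
    m * c                               ∎
    where open ≤-Reasoning

  σ-attains-≥ : (∀ u v → c ≤ val γ u v) → ∀ v → σ γ v ≡ m * c → ∀ u → u ≢ v → val γ u v ≡ c
  σ-attains-≥ c≤ v σv≡ u u≢v = begin
    val γ u v                    ≡⟨ omit-≢ (λ u → val γ u v) u≢v ⟨
    omit v (λ u → val γ u v) u   ≡⟨ tight u ⟨
    omit v (λ _ → c) u           ≡⟨ omit-≢ (λ _ → c) u≢v ⟩
    c                            ∎
    where
    open ≡-Reasoning
    tight : ∀ u → omit v (λ _ → c) u ≡ omit v (λ u → val γ u v) u
    tight = ∑-tight (suc m) (omit-mono v (λ u → c≤ u v))
              (trans (∑-omit-const m c v) (trans (sym σv≡) (σ-as-∑ γ v)))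

  σ-attains-≤ : (∀ u v → val γ u v ≤ c) → ∀ v → σ γ v ≡ m * c → ∀ u → u ≢ v → val γ u v ≡ c
  σ-attains-≤ ≤c v σv≡ u u≢v = begin
    val γ u v                    ≡⟨ omit-≢ (λ u → val γ u v) u≢v ⟨
    omit v (λ u → val γ u v) u   ≡⟨ tight u ⟩
    omit v (λ _ → c) u           ≡⟨ omit-≢ (λ _ → c) u≢v ⟩
    c                            ∎
    where
    open ≡-Reasoning
    tight : ∀ u → omit v (λ u → val γ u v) u ≡ omit v (λ _ → c) u
    tight = ∑-tight (suc m) (omit-mono v (λ u → ≤c u v))
              (trans (sym (σ-as-∑ γ v)) (trans σv≡ (sym (∑-omit-const m c v))))

one-colour-impossible : ∀ {m} (γ : EdgeColouring (suc (suc m)) 1) → ¬ NSD γ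
one-colour-impossible {m} γ nsd = nsd zero (suc zero) (λ ()) (trans (all-equal zero) (sym (all-equal (suc zero))))
  where
  open VertexSumBounds γ 1
  val≡1 : ∀ u v → val γ u v ≡ 1
  val≡1 u v with col γ u v
  ... | zero = refl
  all-equal : ∀ v → σ γ v ≡ suc m * 1
  all-equal v = ≤-antisym (σ-≤ (λ u v → ≤-reflexive (val≡1 u v)) v) (σ-≥ (λ u v → ≤-reflexive (sym (val≡1 u v))) v)

-- With two colours the m+2 distinct sums fill [m+1, 2(m+1)]; a vertex at the bottom
-- sees only colour 1 and one at the top only colour 2, contradicting their common edge.
module TwoColours {m : ℕ} (γ : EdgeColouring (suc (suc m)) 2) (nsd : NSD γ) where
  open VertexSumBounds γ 1 using (σ-≥; σ-attains-≥)
  open VertexSumBounds γ 2 using (σ-≤; σ-attains-≤)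

  1≤val : ∀ u v → 1 ≤ val γ u v
  1≤val u v = s≤s z≤n

  val≤2 : ∀ u v → val γ u v ≤ 2
  val≤2 u v with col γ u v
  ... | zero     = s≤s z≤n
  ... | suc zero = ≤-refl

  low high : ℕ
  low  = suc m * 1
  high = suc m * 2

  low≤σ : ∀ v → low ≤ σ γ v
  low≤σ = σ-≥ 1≤val

  σ≤high : ∀ v → σ γ v ≤ high
  σ≤high = σ-≤ val≤2

  low<high : low < high
  low<high = *-monoʳ-< (suc m) (n<1+n 1)

  gap : high ∸ low ≡ suc m
  gap = trans (cong₂ _∸_ (double (suc m)) (*-identityʳ (suc m))) (m+n∸n≡m (suc m) (suc m))
    where
    double : ∀ s → s * 2 ≡ s + s
    double = solve-∀

  bottom-attained : ∃ λ v → σ γ v ≡ low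
  bottom-attained with hits-zero (suc m) (λ v → σ γ v ∸ low)
                         (λ i j i≢j eq → nsd i j i≢j (∸-cancelʳ-≡ (low≤σ i) (low≤σ j) eq))
                         (λ v → ≤-trans (∸-monoˡ-≤ low (σ≤high v)) (≤-reflexive gap))
  ... | v , σv∸low≡0 = v , ≤-antisym (m∸n≡0⇒m≤n σv∸low≡0) (low≤σ v)

  top-attained : ∃ λ w → σ γ w ≡ high
  top-attained with hits-zero (suc m) (λ w → high ∸ σ γ w)
                      (λ i j i≢j eq → nsd i j i≢j (∸-cancelˡ-≡ (σ≤high i) (σ≤high j) eq))
                      (λ w → ≤-trans (∸-monoʳ-≤ high (low≤σ w)) (≤-reflexive gap))
  ... | w , high∸σw≡0 = w , ≤-antisym (σ≤high w) (m∸n≡0⇒m≤n high∸σw≡0)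

  extremes-clash : (∃ λ v → σ γ v ≡ low) → (∃ λ w → σ γ w ≡ high) → ⊥
  extremes-clash (v , σv≡low) (w , σw≡high) = 1≢2 (begin
    1           ≡⟨ σ-attains-≥ 1≤val v σv≡low w w≢v ⟨
    val γ w v   ≡⟨ cong (suc ∘ toℕ) (col-sym γ w v) ⟩
    val γ v w   ≡⟨ σ-attains-≤ val≤2 w σw≡high v (≢-sym w≢v) ⟩
    2           ∎)
    where
    open ≡-Reasoning
    1≢2 : 1 ≢ 2
    1≢2 ()
    w≢v : w ≢ v
    w≢v w≡v = <⇒≢ low<high (trans (sym σv≡low) (trans (cong (σ γ) (sym w≡v)) σw≡high))

  impossible : ⊥
  impossible = extremes-clash bottom-attained top-attained

at-least-three-colours : ∀ {n k} (γ : EdgeColouring n k) → 2 ≤ n → NSD γ → 3 ≤ k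
at-least-three-colours {k = zero} γ (s≤s (s≤s z≤n)) _ with col γ zero zero
... | ()
at-least-three-colours {k = 1} γ (s≤s (s≤s z≤n)) nsd = ⊥-elim (one-colour-impossible γ nsd)
at-least-three-colours {k = 2} γ (s≤s (s≤s z≤n)) nsd = ⊥-elim (TwoColours.impossible γ nsd)
at-least-three-colours {k = suc (suc (suc k))} γ _ _ = s≤s (s≤s (s≤s z≤n))

c₁ : ∀ {k} → Fin (1 + k)
c₁ = zero
c₂ : ∀ {k} → Fin (2 + k)
c₂ = suc zero
c₃ : ∀ {k} → Fin (3 + k)
c₃ = suc (suc zero)
c₄ : ∀ {k} → Fin (4 + k)
c₄ = suc (suc (suc zero))

-- New vertices ℓ = 0 and h = 1 are put in
-- front, old vertex v becomes 2 + v.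
module Extension {x r : ℕ} (γ : EdgeColouring (x + r) 3) where

  to-ℓ to-h : Fin (x + r) → Fin 3
  to-ℓ v = threshold x c₁ c₂ (toℕ v)
  to-h v = threshold x c₃ c₂ (toℕ v)

  ext-col : Fin (2 + (x + r)) → Fin (2 + (x + r)) → Fin 3
  ext-col zero          zero          = c₂
  ext-col zero          (suc zero)    = c₂
  ext-col zero          (suc (suc v)) = to-ℓ v
  ext-col (suc zero)    zero          = c₂
  ext-col (suc zero)    (suc zero)    = c₂
  ext-col (suc zero)    (suc (suc v)) = to-h v
  ext-col (suc (suc u)) zero          = to-ℓ u
  ext-col (suc (suc u)) (suc zero)    = to-h u
  ext-col (suc (suc u)) (suc (suc v)) = col γ u v

  ext-sym : ∀ i j → ext-col i j ≡ ext-col j i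
  ext-sym zero          zero          = refl
  ext-sym zero          (suc zero)    = refl
  ext-sym zero          (suc (suc v)) = refl
  ext-sym (suc zero)    zero          = refl
  ext-sym (suc zero)    (suc zero)    = refl
  ext-sym (suc zero)    (suc (suc v)) = refl
  ext-sym (suc (suc u)) zero          = refl
  ext-sym (suc (suc u)) (suc zero)    = refl
  ext-sym (suc (suc u)) (suc (suc v)) = col-sym γ u v

  extend : EdgeColouring (2 + (x + r)) 3
  extend = record { col = ext-col ; sym = ext-sym }

  ℓ h : Fin (2 + (x + r))
  ℓ = zero
  h = suc zero

  old : Fin (x + r) → Fin (2 + (x + r))
  old v = suc (suc v)

  ∑-split : ∀ f → ∑ (2 + (x + r)) f ≡ f ℓ + (f h + ∑ (x + r) (f ∘ old))
  ∑-split f = trans (∑-suc (suc (x + r)) f) (cong (f ℓ +_) (∑-suc (x + r) (f ∘ suc)))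

  -- every old vertex gains 1 + 3 or 2 + 2
  σ-old : ∀ v → σ extend (old v) ≡ σ γ v + 4
  σ-old v = begin
    σ extend (old v)                                      ≡⟨ σ-as-∑ extend (old v) ⟩
    ∑ (2 + (x + r)) (omit (old v) (λ u → val extend u (old v))) ≡⟨ ∑-split (omit (old v) (λ u → val extend u (old v))) ⟩
    to-ℓ-value + (to-h-value + ∑ (x + r) (omit v (λ u → val γ u v))) ≡⟨ cong (λ s → to-ℓ-value + (to-h-value + s)) (σ-as-∑ γ v) ⟨
    to-ℓ-value + (to-h-value + σ γ v)                     ≡⟨ sym (+-assoc to-ℓ-value to-h-value (σ γ v)) ⟩
    (to-ℓ-value + to-h-value) + σ γ v                     ≡⟨ cong (_+ σ γ v) gain ⟩
    4 + σ γ v                                             ≡⟨ +-comm 4 (σ γ v) ⟩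
    σ γ v + 4                                             ∎
    where
    open ≡-Reasoning
    to-ℓ-value to-h-value : ℕ
    to-ℓ-value = suc (toℕ (to-ℓ v))
    to-h-value = suc (toℕ (to-h v))
    gain : to-ℓ-value + to-h-value ≡ 4
    gain with toℕ v <ᵇ x
    ... | true  = refl
    ... | false = refl

  σ-ℓ : σ extend ℓ ≡ 2 + (x * 1 + r * 2)
  σ-ℓ = begin
    σ extend ℓ                                          ≡⟨ σ-as-∑ extend ℓ ⟩
    ∑ (2 + (x + r)) (omit ℓ (λ u → val extend u ℓ))     ≡⟨ ∑-split (omit ℓ (λ u → val extend u ℓ)) ⟩
    2 + ∑ (x + r) (λ v → suc (toℕ (to-ℓ v)))            ≡⟨ cong (2 +_) (∑-cong (x + r) (λ v → threshold-map (suc ∘ toℕ) x c₁ c₂ (toℕ v))) ⟩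
    2 + ∑ (x + r) (λ v → threshold x 1 2 (toℕ v))       ≡⟨ cong (2 +_) (∑-threshold x r 1 2) ⟩
    2 + (x * 1 + r * 2)                                 ∎
    where open ≡-Reasoning

  σ-h : σ extend h ≡ 2 + (x * 3 + r * 2)
  σ-h = begin
    σ extend h                                          ≡⟨ σ-as-∑ extend h ⟩
    ∑ (2 + (x + r)) (omit h (λ u → val extend u h))     ≡⟨ ∑-split (omit h (λ u → val extend u h)) ⟩
    2 + ∑ (x + r) (λ v → suc (toℕ (to-h v)))            ≡⟨ cong (2 +_) (∑-cong (x + r) (λ v → threshold-map (suc ∘ toℕ) x c₃ c₂ (toℕ v))) ⟩
    2 + ∑ (x + r) (λ v → threshold x 3 2 (toℕ v))       ≡⟨ cong (2 +_) (∑-threshold x r 3 2) ⟩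
    2 + (x * 3 + r * 2)                                 ∎
    where open ≡-Reasoning

  count-extend : ∀ a → count extend a ≡
    (indicator c₂ a + (x * indicator c₁ a + r * indicator c₂ a))
      + ((x * indicator c₃ a + r * indicator c₂ a) + count γ a)
  count-extend a = begin
    count extend a                                   ≡⟨ count-as-∑ extend a ⟩
    ∑ (2 + (x + r)) row                              ≡⟨ ∑-split row ⟩
    row ℓ + (row h + ∑ (x + r) (row ∘ old))          ≡⟨ cong₂ _+_ row-ℓ (cong₂ _+_ row-h rows-old) ⟩
    (indicator c₂ a + (x * indicator c₁ a + r * indicator c₂ a))
      + ((x * indicator c₃ a + r * indicator c₂ a) + count γ a) ∎
    where
    open ≡-Reasoning
    row : Fin (2 + (x + r)) → ℕ
    row i = ∑ (2 + (x + r)) (edge-indicator extend a i)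
    from-threshold : ∀ p q → ∑ (x + r) (λ v → indicator (threshold x p q (toℕ v)) a) ≡ x * indicator p a + r * indicator q a
    from-threshold p q = trans (∑-cong (x + r) (λ v → threshold-map (λ c → indicator c a) x p q (toℕ v)))
                               (∑-threshold x r (indicator p a) (indicator q a))
    row-ℓ : row ℓ ≡ indicator c₂ a + (x * indicator c₁ a + r * indicator c₂ a)
    row-ℓ = trans (∑-split (edge-indicator extend a ℓ)) (cong (indicator c₂ a +_) (from-threshold c₁ c₂))
    row-h : row h ≡ x * indicator c₃ a + r * indicator c₂ a
    row-h = trans (∑-split (edge-indicator extend a h)) (from-threshold c₃ c₂)
    rows-old : ∑ (x + r) (row ∘ old) ≡ count γ a
    rows-old = trans (∑-cong (x + r) (λ u → ∑-split (edge-indicator extend a (old u)))) (sym (count-as-∑ γ a))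

-- Residue n e: e = 1 exactly when n ≡ 2 (mod 3), i.e. when the number n(n-1)/2 of
-- edges is not divisible by 3; then colour 2 is used once more than colours 1 and 3.
data Residue (n : ℕ) : ℕ → Set where
  mod0 : ∀ k → n ≡ 3 * k     → Residue n 0
  mod1 : ∀ k → n ≡ 3 * k + 1 → Residue n 0
  mod2 : ∀ k → n ≡ 3 * k + 2 → Residue n 1

InWindow : ℕ → ℕ → ℕ → Set
InWindow n M s = 2 * n ≤ s + (M + 2) × s + 2 ≤ 2 * n + M

record Invariant (n : ℕ) : Set where
  field
    γ       : EdgeColouring n 3
    nsd     : NSD γ
    a e M   : ℕ
    count₁  : count γ c₁ ≡ a
    count₂  : count γ c₂ ≡ a + e
    count₃  : count γ c₃ ≡ a
    e≤1     : e ≤ 1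
    residue : Residue n e
    2≤n     : 2 ≤ n
    window  : ∀ v → InWindow n M (σ γ v)
    narrow  : 3 * M + e + 2 ≤ 2 * n

Invariant⇒HasEqNSD : ∀ {n} → Invariant n → HasEqNSD n 3
Invariant⇒HasEqNSD I = γ , nsd , equitable
  where
  open Invariant I
  target : Fin 3 → ℕ
  target zero             = a
  target (suc zero)       = a + e
  target (suc (suc zero)) = a
  count≡ : ∀ c → count γ c ≡ target c
  count≡ zero             = count₁
  count≡ (suc zero)       = count₂
  count≡ (suc (suc zero)) = count₃
  a+e≤1+a : a + e ≤ suc a
  a+e≤1+a = ≤-trans (+-monoʳ-≤ a e≤1) (≤-reflexive (+-comm a 1))
  close : ∀ c d → target c ≤ suc (target d)
  close zero             (suc zero) = m≤n⇒m≤1+n (m≤m+n a e)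
  close (suc (suc zero)) (suc zero) = m≤n⇒m≤1+n (m≤m+n a e)
  close (suc zero)       zero             = a+e≤1+a
  close (suc zero)       (suc (suc zero)) = a+e≤1+a
  close zero             zero             = n≤1+n a
  close zero             (suc (suc zero)) = n≤1+n a
  close (suc (suc zero)) zero             = n≤1+n a
  close (suc (suc zero)) (suc (suc zero)) = n≤1+n a
  close (suc zero)       (suc zero)       = n≤1+n (a + e)
  equitable : Equitable γ
  equitable c d = subst₂ (λ p q → p ≤ suc q) (sym (count≡ c)) (sym (count≡ d)) (close c d)

-- The number x of old vertices joined to ℓ by colour 1 in the step from K_n to K_{n+2},
-- and the resulting excess e′ of colour 2; x is about 2n/3.
record Choice (n e : ℕ) : Set where
  field
    x e′     : ℕ
    balance  : 3 * x + e′ ≡ 2 * n + 1 + e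
    e′≤1     : e′ ≤ 1
    residue′ : Residue (2 + n) e′

choose : ∀ {n e} → Residue n e → Choice n e
choose (mod0 k refl) = record { x = 2 * k ; e′ = 1 ; balance = balanced k ; e′≤1 = ≤-refl ; residue′ = mod2 k (next k) }
  where
  balanced : ∀ k → 3 * (2 * k) + 1 ≡ 2 * (3 * k) + 1 + 0
  balanced = solve-∀
  next : ∀ k → 2 + 3 * k ≡ 3 * k + 2
  next = solve-∀
choose (mod1 k refl) = record { x = 2 * k + 1 ; e′ = 0 ; balance = balanced k ; e′≤1 = z≤n ; residue′ = mod0 (suc k) (next k) }
  where
  balanced : ∀ k → 3 * (2 * k + 1) + 0 ≡ 2 * (3 * k + 1) + 1 + 0
  balanced = solve-∀
  next : ∀ k → 2 + (3 * k + 1) ≡ 3 * suc k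
  next = solve-∀
choose (mod2 k refl) = record { x = 2 * k + 2 ; e′ = 0 ; balance = balanced k ; e′≤1 = z≤n ; residue′ = mod1 (suc k) (next k) }
  where
  balanced : ∀ k → 3 * (2 * k + 2) + 0 ≡ 2 * (3 * k + 2) + 1 + 1
  balanced = solve-∀
  next : ∀ k → 2 + (3 * k + 2) ≡ 3 * suc k + 1
  next = solve-∀

module Balance {n x e e′ : ℕ} (balance : 3 * x + e′ ≡ 2 * n + 1 + e) where

  x≤n : 2 ≤ n → e ≤ 1 → x ≤ n
  x≤n 2≤n e≤1 = *-cancelˡ-≤ 3 (begin
    3 * x          ≤⟨ m≤m+n (3 * x) e′ ⟩
    3 * x + e′     ≡⟨ balance ⟩
    2 * n + 1 + e  ≤⟨ +-monoʳ-≤ (2 * n + 1) e≤1 ⟩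
    2 * n + 1 + 1  ≡⟨ two n ⟩
    2 * n + 2      ≤⟨ +-monoʳ-≤ (2 * n) 2≤n ⟩
    2 * n + n      ≡⟨ three n ⟩
    3 * n          ∎)
    where
    open ≤-Reasoning
    two : ∀ n → 2 * n + 1 + 1 ≡ 2 * n + 2
    two = solve-∀
    three : ∀ n → 2 * n + n ≡ 3 * n
    three = solve-∀

  -- the old radius M is smaller than the new one, x
  M<x : ∀ {M} → e′ ≤ 1 → 3 * M + e + 2 ≤ 2 * n → M < x
  M<x {M} e′≤1 narrow = *-cancelˡ-< 3 M x (+-cancelʳ-≤ 1 (suc (3 * M)) (3 * x) (begin
    suc (3 * M) + 1                 ≤⟨ m≤m+n (suc (3 * M) + 1) (e + 1) ⟩
    suc (3 * M) + 1 + (e + 1)       ≡⟨ regroup M e ⟩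
    3 * M + e + 2 + 1               ≤⟨ +-monoˡ-≤ 1 narrow ⟩
    2 * n + 1                       ≤⟨ m≤m+n (2 * n + 1) e ⟩
    2 * n + 1 + e                   ≡⟨ balance ⟨
    3 * x + e′                      ≤⟨ +-monoʳ-≤ (3 * x) e′≤1 ⟩
    3 * x + 1                       ∎))
    where
    open ≤-Reasoning
    regroup : ∀ M e → suc (3 * M) + 1 + (e + 1) ≡ 3 * M + e + 2 + 1
    regroup = solve-∀

  narrow-next : e ≤ 1 → 3 * x + e′ + 2 ≤ 2 * (2 + n)
  narrow-next e≤1 = begin
    3 * x + e′ + 2    ≡⟨ cong (_+ 2) balance ⟩
    2 * n + 1 + e + 2 ≤⟨ +-monoˡ-≤ 2 (+-monoʳ-≤ (2 * n + 1) e≤1) ⟩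
    2 * n + 1 + 1 + 2 ≡⟨ four n ⟩
    2 * (2 + n)       ∎
    where
    open ≤-Reasoning
    four : ∀ n → 2 * n + 1 + 1 + 2 ≡ 2 * (2 + n)
    four = solve-∀

  -- colour 2 gains 1 + 2r edges, which is x + e′ − e
  colour-2-gain : ∀ {r} → n ≡ x + r → 2 * r + 1 + e ≡ x + e′
  colour-2-gain {r} refl = +-cancelˡ-≡ (x + x) _ _ (begin
    (x + x) + (2 * r + 1 + e)   ≡⟨ regroup x r e ⟩
    2 * (x + r) + 1 + e         ≡⟨ balance ⟨
    3 * x + e′                  ≡⟨ triple x e′ ⟩
    (x + x) + (x + e′)          ∎)
    where
    open ≡-Reasoning
    regroup : ∀ x r e → (x + x) + (2 * r + 1 + e) ≡ 2 * (x + r) + 1 + e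
    regroup = solve-∀
    triple : ∀ x e′ → 3 * x + e′ ≡ (x + x) + (x + e′)
    triple = solve-∀

shift-window : ∀ {n M x s} → M < x → InWindow n M s →
               2 * (2 + n) < (s + 4) + (x + 2) × (s + 4) + 2 < 2 * (2 + n) + x
shift-window {n} {M} {x} {s} M<x (lower , upper) = above , below
  where
  open ≤-Reasoning
  above : 2 * (2 + n) < (s + 4) + (x + 2)
  above = begin-strict
    2 * (2 + n)        ≡⟨ double-plus n ⟩
    2 * n + 4          ≤⟨ +-monoˡ-≤ 4 lower ⟩
    s + (M + 2) + 4    <⟨ +-monoˡ-< 4 (+-monoʳ-< s (+-monoˡ-< 2 M<x)) ⟩
    s + (x + 2) + 4    ≡⟨ swap s (x + 2) ⟩
    (s + 4) + (x + 2)  ∎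
    where
    double-plus : ∀ n → 2 * (2 + n) ≡ 2 * n + 4
    double-plus = solve-∀
    swap : ∀ s y → s + y + 4 ≡ s + 4 + y
    swap = solve-∀
  below : (s + 4) + 2 < 2 * (2 + n) + x
  below = begin-strict
    (s + 4) + 2        ≡⟨ swap s ⟩
    s + 2 + 4          ≤⟨ +-monoˡ-≤ 4 upper ⟩
    2 * n + M + 4      <⟨ +-monoˡ-< 4 (+-monoʳ-< (2 * n) M<x) ⟩
    2 * n + x + 4      ≡⟨ double-plus n x ⟩
    2 * (2 + n) + x    ∎
    where
    swap : ∀ s → s + 4 + 2 ≡ s + 2 + 4
    swap = solve-∀
    double-plus : ∀ n x → 2 * n + x + 4 ≡ 2 * (2 + n) + x
    double-plus = solve-∀

-- In K_{n+2} the vertex ℓ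
-- sits at the bottom of the new window, h at its top, and all old vertices strictly in
-- between, so new sums are distinct from everything else.
grow-by : ∀ {n} (I : Invariant n) x r e′ → x + r ≡ n →
          3 * x + e′ ≡ 2 * n + 1 + Invariant.e I → e′ ≤ 1 → Residue (2 + n) e′ → Invariant (2 + n)
grow-by I x r e′ refl balance e′≤1 residue′ = record
  { γ = extend ; nsd = nsd′ ; a = a + x ; e = e′ ; M = x
  ; count₁ = trans (count-extend c₁) (trans (cong (λ z → x * 1 + r * 0 + (x * 0 + r * 0 + z)) count₁) (gain-1 x r a))
  ; count₂ = trans (count-extend c₂) (trans (cong (λ z → 1 + (x * 0 + r * 1) + (x * 0 + r * 1 + z)) count₂) gain-2)
  ; count₃ = trans (count-extend c₃) (trans (cong (λ z → x * 0 + r * 0 + (x * 1 + r * 0 + z)) count₃) (gain-3 x r a))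
  ; e≤1 = e′≤1 ; residue = residue′ ; 2≤n = s≤s (s≤s z≤n)
  ; window = window′ ; narrow = narrow-next e≤1 }
  where
  open Invariant I
  open Extension {x} {r} γ
  open Balance {x + r} {x} {e} {e′} balance
  N : ℕ
  N = 2 + (x + r)

  gain-1 : ∀ x r a → x * 1 + r * 0 + (x * 0 + r * 0 + a) ≡ a + x
  gain-1 = solve-∀
  gain-3 : ∀ x r a → x * 0 + r * 0 + (x * 1 + r * 0 + a) ≡ a + x
  gain-3 = solve-∀
  gain-2 : 1 + (x * 0 + r * 1) + (x * 0 + r * 1 + (a + e)) ≡ a + x + e′
  gain-2 = begin
    1 + (x * 0 + r * 1) + (x * 0 + r * 1 + (a + e)) ≡⟨ regroup x r a e ⟩
    a + (2 * r + 1 + e)                             ≡⟨ cong (a +_) (colour-2-gain refl) ⟩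
    a + (x + e′)                                    ≡⟨ +-assoc a x e′ ⟨
    a + x + e′                                      ∎
    where
    open ≡-Reasoning
    regroup : ∀ x r a e → 1 + (x * 0 + r * 1) + (x * 0 + r * 1 + (a + e)) ≡ a + (2 * r + 1 + e)
    regroup = solve-∀

  M<x′ : M < x
  M<x′ = M<x {M} e′≤1 narrow
  0<x : 0 < x
  0<x = ≤-<-trans z≤n M<x′

  ℓ-bottom : σ extend ℓ + (x + 2) ≡ 2 * N
  ℓ-bottom = trans (cong (_+ (x + 2)) σ-ℓ) (bottom x r)
    where
    bottom : ∀ x r → 2 + (x * 1 + r * 2) + (x + 2) ≡ 2 * (2 + (x + r))
    bottom = solve-∀
  h-top : σ extend h + 2 ≡ 2 * N + x
  h-top = trans (cong (_+ 2) σ-h) (top x r)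
    where
    top : ∀ x r → 2 + (x * 3 + r * 2) + 2 ≡ 2 * (2 + (x + r)) + x
    top = solve-∀
  old-inside : ∀ v → 2 * N < σ extend (old v) + (x + 2) × σ extend (old v) + 2 < 2 * N + x
  old-inside v = subst (λ s → 2 * N < s + (x + 2) × s + 2 < 2 * N + x) (sym (σ-old v))
                       (shift-window M<x′ (window v))

  ℓ<old : ∀ v → σ extend ℓ < σ extend (old v)
  ℓ<old v = +-cancelʳ-< (x + 2) _ _ (subst (_< σ extend (old v) + (x + 2)) (sym ℓ-bottom) (proj₁ (old-inside v)))
  old<h : ∀ v → σ extend (old v) < σ extend h
  old<h v = +-cancelʳ-< 2 _ _ (subst (σ extend (old v) + 2 <_) (sym h-top) (proj₂ (old-inside v)))
  ℓ<h : σ extend ℓ < σ extend h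
  ℓ<h = +-cancelʳ-< (x + 2) _ _ (begin-strict
    σ extend ℓ + (x + 2)   ≡⟨ ℓ-bottom ⟩
    2 * N                  <⟨ m<m+n (2 * N) 0<x ⟩
    2 * N + x              ≡⟨ h-top ⟨
    σ extend h + 2         ≤⟨ +-monoʳ-≤ (σ extend h) (m≤n+m 2 x) ⟩
    σ extend h + (x + 2)   ∎)
    where open ≤-Reasoning

  window′ : ∀ v → InWindow N x (σ extend v)
  window′ zero = ≤-reflexive (sym ℓ-bottom) , (begin
    σ extend ℓ + 2         ≤⟨ +-monoʳ-≤ (σ extend ℓ) (m≤n+m 2 x) ⟩
    σ extend ℓ + (x + 2)   ≡⟨ ℓ-bottom ⟩
    2 * N                  ≤⟨ m≤m+n (2 * N) x ⟩
    2 * N + x              ∎)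
    where open ≤-Reasoning
  window′ (suc zero) = (begin
    2 * N                  ≤⟨ m≤m+n (2 * N) x ⟩
    2 * N + x              ≡⟨ h-top ⟨
    σ extend h + 2         ≤⟨ +-monoʳ-≤ (σ extend h) (m≤n+m 2 x) ⟩
    σ extend h + (x + 2)   ∎) , ≤-reflexive h-top
    where open ≤-Reasoning
  window′ (suc (suc v)) = <⇒≤ (proj₁ (old-inside v)) , <⇒≤ (proj₂ (old-inside v))

  nsd′ : NSD extend
  nsd′ zero          zero          ℓ≢ℓ _ = ℓ≢ℓ refl
  nsd′ (suc zero)    (suc zero)    h≢h _ = h≢h refl
  nsd′ zero          (suc zero)    _ = <⇒≢ ℓ<h
  nsd′ (suc zero)    zero          _ = ≢-sym (<⇒≢ ℓ<h)
  nsd′ zero          (suc (suc v)) _ = <⇒≢ (ℓ<old v)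
  nsd′ (suc (suc v)) zero          _ = ≢-sym (<⇒≢ (ℓ<old v))
  nsd′ (suc zero)    (suc (suc v)) _ = ≢-sym (<⇒≢ (old<h v))
  nsd′ (suc (suc v)) (suc zero)    _ = <⇒≢ (old<h v)
  nsd′ (suc (suc u)) (suc (suc v)) u≢v σ≡ =
    nsd u v (λ u≡v → u≢v (cong old u≡v))
      (+-cancelʳ-≡ 4 (σ γ u) (σ γ v) (trans (sym (σ-old u)) (trans σ≡ (σ-old v))))

grow : ∀ {n} → Invariant n → Invariant (2 + n)
grow {n} I = grow-by I x (n ∸ x) e′ (m+[n∸m]≡n (x≤n 2≤n e≤1)) balance e′≤1 residue′
  where
  open Invariant I
  open Choice (choose residue)
  open Balance {n} {x} {e} {e′} balance

InWindow? : ∀ {n k} (γ : EdgeColouring n k) M → Dec (∀ v → InWindow n M (σ γ v))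
InWindow? {n} γ M = all? λ v → (2 * n ≤? σ γ v + (M + 2)) ×-dec (σ γ v + 2 ≤? 2 * n + M)

-- K_3: vertex sums 3, 4, 5; each colour once.  Diagonal entries are never used.
K₃ : EdgeColouring 3 3
K₃ = fromMatrix
  ((c₂ ∷ c₁ ∷ c₂ ∷ []) ∷
   (c₁ ∷ c₂ ∷ c₃ ∷ []) ∷
   (c₂ ∷ c₃ ∷ c₂ ∷ []) ∷ [])

invariant₃ : Invariant 3
invariant₃ = record
  { γ = K₃ ; nsd = from-yes (NSD? K₃) ; a = 1 ; e = 0 ; M = 1
  ; count₁ = refl ; count₂ = refl ; count₃ = refl
  ; e≤1 = z≤n ; residue = mod0 1 refl ; 2≤n = s≤s (s≤s z≤n)
  ; window = from-yes (InWindow? K₃ 1) ; narrow = from-yes (3 * 1 + 0 + 2 ≤? 2 * 3) }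

-- K_6: vertex sums 7, 8, 9, 11, 12, 13; each colour five times.
K₆ : EdgeColouring 6 3
K₆ = fromMatrix
  ((c₂ ∷ c₁ ∷ c₁ ∷ c₁ ∷ c₁ ∷ c₃ ∷ []) ∷
   (c₁ ∷ c₂ ∷ c₁ ∷ c₂ ∷ c₂ ∷ c₂ ∷ []) ∷
   (c₁ ∷ c₁ ∷ c₂ ∷ c₂ ∷ c₃ ∷ c₂ ∷ []) ∷
   (c₁ ∷ c₂ ∷ c₂ ∷ c₂ ∷ c₃ ∷ c₃ ∷ []) ∷
   (c₁ ∷ c₂ ∷ c₃ ∷ c₃ ∷ c₂ ∷ c₃ ∷ []) ∷
   (c₃ ∷ c₂ ∷ c₂ ∷ c₃ ∷ c₃ ∷ c₂ ∷ []) ∷ [])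

invariant₆ : Invariant 6
invariant₆ = record
  { γ = K₆ ; nsd = from-yes (NSD? K₆) ; a = 5 ; e = 0 ; M = 3
  ; count₁ = refl ; count₂ = refl ; count₃ = refl
  ; e≤1 = z≤n ; residue = mod0 2 refl ; 2≤n = s≤s (s≤s z≤n)
  ; window = from-yes (InWindow? K₆ 3) ; narrow = from-yes (3 * 3 + 0 + 2 ≤? 2 * 6) }

-- Every n ≥ 3 other than 4 is reached from 3 or 6 by steps of 2.
invariant : ∀ n → 3 ≤ n → n ≢ 4 → Invariant n
invariant 0 () _
invariant 1 (s≤s ()) _
invariant 2 (s≤s (s≤s ())) _
invariant 3 _ _ = invariant₃
invariant 4 _ 4≢4 = ⊥-elim (4≢4 refl)
invariant 5 _ _ = grow invariant₃
invariant 6 _ _ = invariant₆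
invariant (suc (suc (suc (suc (suc (suc (suc m))))))) _ _ =
  grow (invariant (suc (suc (suc (suc (suc m))))) (s≤s (s≤s (s≤s z≤n))) (λ ()))

-- K_4: vertex sums 4, 6, 7, 9 with colours 1, 1, 2, 2, 3, 4.
K₄ : EdgeColouring 4 4
K₄ = fromMatrix
  ((c₁ ∷ c₁ ∷ c₁ ∷ c₂ ∷ []) ∷
   (c₁ ∷ c₁ ∷ c₂ ∷ c₃ ∷ []) ∷
   (c₁ ∷ c₂ ∷ c₁ ∷ c₄ ∷ []) ∷
   (c₂ ∷ c₃ ∷ c₄ ∷ c₁ ∷ []) ∷ [])

K₄-with-four-colours : HasEqNSD 4 4
K₄-with-four-colours = K₄ , from-yes (EqNSD? K₄)

patch : (Fin 4 → Fin 4 → Fin 3) → (c₀₁ c₀₂ c₀₃ c₁₂ c₁₃ c₂₃ : Fin 3) → Fin 4 → Fin 4 → Fin 3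
patch d c₀₁ c₀₂ c₀₃ c₁₂ c₁₃ c₂₃ zero             (suc zero)             = c₀₁
patch d c₀₁ c₀₂ c₀₃ c₁₂ c₁₃ c₂₃ zero             (suc (suc zero))       = c₀₂
patch d c₀₁ c₀₂ c₀₃ c₁₂ c₁₃ c₂₃ zero             (suc (suc (suc zero))) = c₀₃
patch d c₀₁ c₀₂ c₀₃ c₁₂ c₁₃ c₂₃ (suc zero)       (suc (suc zero))       = c₁₂
patch d c₀₁ c₀₂ c₀₃ c₁₂ c₁₃ c₂₃ (suc zero)       (suc (suc (suc zero))) = c₁₃
patch d c₀₁ c₀₂ c₀₃ c₁₂ c₁₃ c₂₃ (suc (suc zero)) (suc (suc (suc zero))) = c₂₃
patch d c₀₁ c₀₂ c₀₃ c₁₂ c₁₃ c₂₃ i                j                      = d i j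

patch-self : ∀ (d : Fin 4 → Fin 4 → Fin 3) i j →
  patch d (d zero (suc zero)) (d zero (suc (suc zero))) (d zero (suc (suc (suc zero))))
          (d (suc zero) (suc (suc zero))) (d (suc zero) (suc (suc (suc zero))))
          (d (suc (suc zero)) (suc (suc (suc zero)))) i j ≡ d i j
patch-self d zero             zero                   = refl
patch-self d zero             (suc zero)             = refl
patch-self d zero             (suc (suc zero))       = refl
patch-self d zero             (suc (suc (suc zero))) = refl
patch-self d (suc zero)       zero                   = refl
patch-self d (suc zero)       (suc zero)             = refl
patch-self d (suc zero)       (suc (suc zero))       = refl
patch-self d (suc zero)       (suc (suc (suc zero))) = refl
patch-self d (suc (suc zero)) zero                   = refl
patch-self d (suc (suc zero)) (suc zero)             = refl
patch-self d (suc (suc zero)) (suc (suc zero))       = refl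
patch-self d (suc (suc zero)) (suc (suc (suc zero))) = refl
patch-self d (suc (suc (suc zero))) j                = refl

-- Exhaustive search: none of the 3^6 ways of colouring the edges of K_4 is both NSD
-- and equitable (the diagonal d is irrelevant and stays symbolic).
K₄-search : ∀ d c₀₁ c₀₂ c₀₃ c₁₂ c₁₃ c₂₃ →
  ¬ (NSD (fromUpper (patch d c₀₁ c₀₂ c₀₃ c₁₂ c₁₃ c₂₃)) × Equitable (fromUpper (patch d c₀₁ c₀₂ c₀₃ c₁₂ c₁₃ c₂₃)))
K₄-search d = toWitness {a? = all? λ c₀₁ → all? λ c₀₂ → all? λ c₀₃ → all? λ c₁₂ → all? λ c₁₃ → all? λ c₂₃ →
  ¬? (EqNSD? (fromUpper (patch d c₀₁ c₀₂ c₀₃ c₁₂ c₁₃ c₂₃)))} tt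

-- Every 3-colouring of K_4 coincides with a searched one, so none is equitable and NSD.
K₄-not-with-three-colours : ¬ HasEqNSD 4 3
K₄-not-with-three-colours (γ , good) =
  K₄-search d (d zero (suc zero)) (d zero (suc (suc zero))) (d zero (suc (suc (suc zero))))
            (d (suc zero) (suc (suc zero))) (d (suc zero) (suc (suc (suc zero))))
            (d (suc (suc zero)) (suc (suc (suc zero))))
            (transfer γ _ (λ i j → sym (fromUpper-agrees γ _ (patch-self d) i j)) good)
  where
  d : Fin 4 → Fin 4 → Fin 3
  d = col γ

lower-bound : ∀ {n} → 2 ≤ n → ∀ k → HasEqNSD n k → 3 ≤ k
lower-bound 2≤n k (γ , nsd , _) = at-least-three-colours γ 2≤n nsd

K₄-needs-four : ∀ k → HasEqNSD 4 k → 4 ≤ k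
K₄-needs-four k H with k ≟ℕ 3
... | yes refl = ⊥-elim (K₄-not-with-three-colours H)
... | no k≢3   = ≤∧≢⇒< (lower-bound (s≤s (s≤s z≤n)) k H) (≢-sym k≢3)

theorem1 : (∀ (n : ℕ) → 3 ≤ n → n ≢ 4 → EqNSDIndex≡ n 3) × EqNSDIndex≡ 4 4
theorem1 =
  (λ n 3≤n n≢4 → Invariant⇒HasEqNSD (invariant n 3≤n n≢4) , lower-bound (≤-trans (n≤1+n 2) 3≤n)) ,
  (K₄-with-four-colours , K₄-needs-four)
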